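{- Let $G$ be a connected graph and $M$ its metamour graph. Then the following are equivalent: (a) $M=\overline{G}$ and $M$ has at least two connected components; (b) $G=\overline{M_1}\nabla\cdots\nabla\overline{M_t}$ where $\{M_1,\dots,M_t\}$ is the set of connected components of $M$ and $t\ge2$; (c) there are graphs $G_1$ and $G_2$ with $G=G_1\nabla G_2$.
   Context: All graphs are finite, simple and have at least one vertex; isomorphic graphs are regarded as equal. A vertex $v$ is a metamour of a vertex $w$ in $G$ if their distance in $G$ equals $2$. The metamour graph of $G$ is the graph on $V(G)$ with an edge between $v$ and $w$ whenever $v$ is a metamour of $w$ in $G$. $\overline{H}$ denotes the complement of $H$. For graphs $G_1,G_2$ with disjoint vertex sets (made disjoint if necessary), the join $G_1\nabla G_2$ is the graph with vertex set $V(G_1)\cup V(G_2)$ and edge set $E(G_1)\cup E(G_2)\cup\{\{g_1,g_2\}: g_1\in V(G_1), g_2\in V(G_2)\}$; the join is associative and commutative. -}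

module Defs where

open import Data.Nat using (ℕ; zero; suc)
open import Data.Fin using (Fin; zero; suc)
open import Data.Product using (Σ; ∃; _×_; _,_; proj₁; proj₂)
open import Data.Sum using (_⊎_; inj₁; inj₂)
open import Data.Unit using (⊤; tt)
open import Data.Empty using (⊥)
open import Function using (_∘_)
open import Function.Bundles using (_↔_; _⇔_; Inverse)
open import Relation.Nullary using (¬_)
open import Relation.Binary.PropositionalEquality using (_≡_; refl; sym)
open import Relation.Binary using (Decidable)

record Graph : Set₁ where
  field
    V      : Set
    E      : V → V → Set
    E-sym  : ∀ {x y} → E x y → E y x
    E-irr  : ∀ {x} → ¬ E x x
    point  : V
open Graph public

Finite : Graph → Set
Finite G = ∃ λ n → V G ↔ Fin n

-- Adjacency is decidable (automatic classically for finite graphs).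
DecAdj : Graph → Set
DecAdj G = Decidable (E G)

-- Isomorphism of graphs ("isomorphic graphs are regarded as equal").
record _≅_ (G H : Graph) : Set where
  field
    bij    : V G ↔ V H
    adj⇔   : ∀ x y → E G x y ⇔ E H (Inverse.to bij x) (Inverse.to bij y)
open _≅_ public

data Reach (G : Graph) : V G → V G → Set where
  here : ∀ {x} → Reach G x x
  step : ∀ {x y z} → E G x y → Reach G y z → Reach G x z

Connected : Graph → Set
Connected G = ∀ x y → Reach G x y

Dist2 : (G : Graph) → V G → V G → Set
Dist2 G x y = ¬ (x ≡ y) × ¬ E G x y × ∃ λ u → E G x u × E G u y

metamour : Graph → Graph
metamour G = record
  { V = V G
  ; E = Dist2 G
  ; E-sym = λ { (n≡ , nE , u , xu , uy) →
        (λ e → n≡ (sym e)) , (λ e → nE (E-sym G e)) , u , E-sym G uy , E-sym G xu }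
  ; E-irr = λ { (n≡ , _) → n≡ refl }
  ; point = point G
  }

complement : Graph → Graph
complement G = record
  { V = V G
  ; E = λ x y → ¬ (x ≡ y) × ¬ E G x y
  ; E-sym = λ { (n≡ , nE) → (λ e → n≡ (sym e)) , (λ e → nE (E-sym G e)) }
  ; E-irr = λ { (n≡ , _) → n≡ refl }
  ; point = point G
  }

JE : (G₁ G₂ : Graph) → V G₁ ⊎ V G₂ → V G₁ ⊎ V G₂ → Set
JE G₁ G₂ (inj₁ x) (inj₁ y) = E G₁ x y
JE G₁ G₂ (inj₂ x) (inj₂ y) = E G₂ x y
JE G₁ G₂ (inj₁ x) (inj₂ y) = ⊤
JE G₁ G₂ (inj₂ x) (inj₁ y) = ⊤

JE-sym : (G₁ G₂ : Graph) → ∀ {x y} → JE G₁ G₂ x y → JE G₁ G₂ y x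
JE-sym G₁ G₂ {inj₁ x} {inj₁ y} e = E-sym G₁ e
JE-sym G₁ G₂ {inj₂ x} {inj₂ y} e = E-sym G₂ e
JE-sym G₁ G₂ {inj₁ x} {inj₂ y} e = tt
JE-sym G₁ G₂ {inj₂ x} {inj₁ y} e = tt

JE-irr : (G₁ G₂ : Graph) → ∀ {x} → ¬ JE G₁ G₂ x x
JE-irr G₁ G₂ {inj₁ x} = E-irr G₁
JE-irr G₁ G₂ {inj₂ x} = E-irr G₂

infixr 5 _∇_
_∇_ : Graph → Graph → Graph
G₁ ∇ G₂ = record
  { V = V G₁ ⊎ V G₂
  ; E = JE G₁ G₂
  ; E-sym = λ {x} {y} → JE-sym G₁ G₂ {x} {y}
  ; E-irr = λ {x} → JE-irr G₁ G₂ {x}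
  ; point = inj₁ (point G₁)
  }

bigJoin : (t : ℕ) → (Fin (suc t) → Graph) → Graph
bigJoin zero    H = H zero
bigJoin (suc t) H = H zero ∇ bigJoin t (H ∘ suc)

record Components (H : Graph) (t : ℕ) : Set where
  field
    label     : V H → Fin t
    rep       : Fin t → V H
    rep-label : ∀ i → label (rep i) ≡ i
    same      : ∀ x y → (label x ≡ label y) ⇔ Reach H x y
open Components public

component : (H : Graph) {t : ℕ} → Components H t → Fin t → Graph
component H L i = record
  { V = Σ (V H) (λ v → label L v ≡ i)
  ; E = λ x y → E H (proj₁ x) (proj₁ y)
  ; E-sym = E-sym H
  ; E-irr = E-irr H
  ; point = rep L i , rep-label L i
  }

-- Call a labelling of the vertices of G "adjacent across" if vertices with different labels are
-- always adjacent. With at least two classes, two distinct non-adjacent vertices then have a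
-- common neighbour in another class, so G has diameter two, its metamour graph is its complement,
-- and metamour walks never leave a class. The two sides of a join G₁ ∇ G₂ form such a splitting,
-- so its metamour graph is disconnected; conversely the components of a disconnected complement
-- form such a splitting, and G is the join of the complements of these components.

module Submission where

open import Defs
open import Axiom.UniquenessOfIdentityProofs using (module Decidable⇒UIP)
open import Data.Bool using (Bool; true; false)
import Data.Bool.Properties as Bool
open import Data.Empty using (⊥-elim)
open import Data.Fin using (Fin; zero; suc; toℕ; punchIn; _≟_)
open import Data.Fin.Properties
  using (any?; all?; ¬∀⟶∃¬; pigeonhole; punchInᵢ≢i; inj⇒≟; suc-injective)
open import Data.Nat using (ℕ; zero; suc; _≤′_; ≤′-refl; ≤′-step)
open import Data.Nat.Properties using (n<1+n; ≤⇒≤′)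
open import Data.Product using (Σ; ∃; _×_; _,_; proj₁; proj₂; uncurry)
import Data.Product as Product
open import Data.Sum using (_⊎_; inj₁; inj₂)
open import Data.Unit using (tt)
open import Function using (_∘_; id)
open import Level using (0ℓ)
open import Function.Bundles using (_⇔_; _↔_; Inverse; Equivalence; mk⇔; mk↔ₛ′)
open import Function.Construct.Identity using (↔-id)
open import Function.Properties.Inverse using (↔⇒↣)
open import Relation.Binary using (Rel; IsDecEquivalence; DecidableEquality)
import Relation.Binary.Construct.On as On
open import Relation.Binary.PropositionalEquality
open import Relation.Nullary using (¬_; Dec; yes; no; contradiction; ¬?)
open import Relation.Nullary.Decidable using (decidable-stable; map′; _×-dec_; _→-dec_)
open import Relation.Unary using (Pred; _⊆_)

open Inverse using (to; from; strictlyInverseˡ; strictlyInverseʳ)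
open Equivalence using () renaming (to to ⇒; from to ⇐)

reach-map : ∀ {G H} (f : V G → V H) → (∀ {x y} → E G x y → E H (f x) (f y)) →
            ∀ {x y} → Reach G x y → Reach H (f x) (f y)
reach-map f hom here       = here
reach-map f hom (step e r) = step (hom e) (reach-map f hom r)

reach-snoc : ∀ {G x y z} → Reach G x y → E G y z → Reach G x z
reach-snoc here        e = step e here
reach-snoc (step e′ r) e = step e′ (reach-snoc r e)

reach-trans : ∀ {G x y z} → Reach G x y → Reach G y z → Reach G x z
reach-trans here       r′ = r′
reach-trans (step e r) r′ = step e (reach-trans r r′)

reach-sym : ∀ {G x y} → Reach G x y → Reach G y x
reach-sym here           = here
reach-sym {G} (step e r) = reach-snoc (reach-sym r) (E-sym G e)

module _ {G H : Graph} (φ : G ≅ H) where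
  private b = bij φ

  ≅-to-adj : ∀ {x y} → E G x y → E H (to b x) (to b y)
  ≅-to-adj = ⇒ (adj⇔ φ _ _)

  ≅-from-adj : ∀ {x y} → E H x y → E G (from b x) (from b y)
  ≅-from-adj {x} {y} e =
    ⇐ (adj⇔ φ _ _) (subst₂ (E H) (sym (strictlyInverseˡ b x)) (sym (strictlyInverseˡ b y)) e)

  components-≅ : ∀ {t} → Components G t → Components H t
  components-≅ L = record
    { label     = label L ∘ from b
    ; rep       = to b ∘ rep L
    ; rep-label = λ i → trans (cong (label L) (strictlyInverseʳ b (rep L i))) (rep-label L i)
    ; same      = λ x y → mk⇔
        (λ eq → subst₂ (Reach H) (strictlyInverseˡ b x) (strictlyInverseˡ b y)
                  (reach-map (to b) ≅-to-adj (⇒ (same L _ _) eq)))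
        (λ r → ⇐ (same L _ _) (reach-map (from b) ≅-from-adj r))
    }

-- Deciding reachability in a finite graph

-- The witnesses of strict growth at the steps 0, …, n would be n + 1
-- distinct elements of Fin n.
chain-stabilises : ∀ {n} (P : ℕ → Pred (Fin n) 0ℓ) → (∀ m i → Dec (P m i)) →
                   (∀ m → P m ⊆ P (suc m)) → ∃ λ m → P (suc m) ⊆ P m
chain-stabilises {n} P P? grow
  with any? (λ (m : Fin (suc n)) → all? (λ i → P? (suc (toℕ m)) i →-dec P? (toℕ m) i))
... | yes (m , stable) = toℕ m , λ {i} → stable i
... | no unstable =
  let (i , j , i<j , same-new) = pigeonhole (n<1+n n) (proj₁ ∘ new)
  in  contradiction (subst (P (toℕ j)) same-new (grow* (≤⇒≤′ i<j) (proj₁ (proj₂ (new i)))))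
                    (proj₂ (proj₂ (new j)))
  where
  grow* : ∀ {m m′} → m ≤′ m′ → P m ⊆ P m′
  grow* ≤′-refl        = id
  grow* (≤′-step m≤m′) = grow _ ∘ grow* m≤m′

  new : (m : Fin (suc n)) → ∃ λ i → P (suc (toℕ m)) i × ¬ P (toℕ m) i
  new m with ¬∀⟶∃¬ n _ (λ i → P? (suc (toℕ m)) i →-dec P? (toℕ m) i) (λ st → unstable (m , st))
  ... | i , ¬step =
    i , decidable-stable (P? _ i) (λ ¬p → ¬step (⊥-elim ∘ ¬p)) , λ p → ¬step (λ _ → p)

Reach≤ : (H : Graph) → ℕ → V H → V H → Set
Reach≤ H zero    x y = x ≡ y
Reach≤ H (suc m) x y = Reach≤ H m x y ⊎ ∃ λ z → Reach≤ H m x z × E H z y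

module _ {H : Graph} where

  Reach≤⇒Reach : ∀ m {x y} → Reach≤ H m x y → Reach H x y
  Reach≤⇒Reach zero    refl                = here
  Reach≤⇒Reach (suc m) (inj₁ r)            = Reach≤⇒Reach m r
  Reach≤⇒Reach (suc m) (inj₂ (z , r , e)) = reach-snoc (Reach≤⇒Reach m r) e

  Reach⇒Reach≤ : ∀ {x y} → Reach H x y → ∃ λ m → Reach≤ H m x y
  Reach⇒Reach≤ = extend 0 refl
    where
    extend : ∀ m {x y z} → Reach≤ H m x y → Reach H y z → ∃ λ m′ → Reach≤ H m′ x z
    extend m r here        = m , r
    extend m r (step e r′) = extend (suc m) (inj₂ (_ , r , e)) r′

  Reach≤-refl : ∀ m {x} → Reach≤ H m x x
  Reach≤-refl zero    = refl
  Reach≤-refl (suc m) = inj₁ (Reach≤-refl m)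

  Reach≤-closed : ∀ {m x} → (∀ {y} → Reach≤ H (suc m) x y → Reach≤ H m x y) →
                  ∀ m′ {y} → Reach≤ H m′ x y → Reach≤ H m x y
  Reach≤-closed {m} closed zero refl = Reach≤-refl m
  Reach≤-closed closed (suc m′) (inj₁ r) = Reach≤-closed closed m′ r
  Reach≤-closed closed (suc m′) (inj₂ (z , r , e)) =
    closed (inj₂ (z , Reach≤-closed closed m′ r , e))

module _ (H : Graph) {n} (β : V H ↔ Fin n) (E? : DecAdj H) where

  private
    any-vertex? : {P : V H → Set} → (∀ v → Dec (P v)) → Dec (∃ P)
    any-vertex? {P} P? = map′
      (λ (i , p) → from β i , p)
      (λ (v , p) → to β v , subst P (sym (strictlyInverseʳ β v)) p)
      (any? (P? ∘ from β))

  reach≤? : ∀ m x y → Dec (Reach≤ H m x y)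
  reach≤? zero    x y = inj⇒≟ (↔⇒↣ β) x y
  reach≤? (suc m) x y with reach≤? m x y
  ... | yes r = yes (inj₁ r)
  ... | no ¬r = map′ inj₂ (λ { (inj₁ r) → ⊥-elim (¬r r) ; (inj₂ w) → w })
                  (any-vertex? (λ z → reach≤? m x z ×-dec E? z y))

  reach? : ∀ x y → Dec (Reach H x y)
  reach? x y with chain-stabilises (λ m i → Reach≤ H m x (from β i))
                    (λ m i → reach≤? m x (from β i)) (λ m → inj₁)
  ... | m , stable =
    map′ (Reach≤⇒Reach m) (λ r → Reach≤-closed closed _ (proj₂ (Reach⇒Reach≤ r))) (reach≤? m x y)
    where
    closed : ∀ {y} → Reach≤ H (suc m) x y → Reach≤ H m x y
    closed {y} r = subst (Reach≤ H m x) (strictlyInverseʳ β y)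
                     (stable (subst (Reach≤ H (suc m) x) (sym (strictlyInverseʳ β y)) r))

-- Connected components of a finite graph

record Labelling {A : Set} (R : Rel A 0ℓ) (t : ℕ) : Set where
  field
    classOf        : A → Fin t
    representative : Fin t → A
    classOf-rep    : ∀ i → classOf (representative i) ≡ i
    same-class     : ∀ x y → (classOf x ≡ classOf y) ⇔ R x y

module _ {n} {R : Rel (Fin (suc n)) 0ℓ} (isDecEq : IsDecEquivalence R)
         {t} (L : Labelling (λ i j → R (suc i) (suc j)) t) where
  open IsDecEquivalence isDecEq using () renaming (refl to R-refl; sym to R-sym; trans to R-trans)
  open Labelling L

  extend-into-class : ∀ j → R zero (suc j) → Labelling R t
  extend-into-class j R0j = record
    { classOf = classOf′ ; representative = suc ∘ representative
    ; classOf-rep = classOf-rep ; same-class = same′ }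
    where
    classOf′ : Fin (suc n) → Fin t
    classOf′ zero    = classOf j
    classOf′ (suc x) = classOf x
    same′ : ∀ x y → (classOf′ x ≡ classOf′ y) ⇔ R x y
    same′ zero    zero    = mk⇔ (λ _ → R-refl) (λ _ → refl)
    same′ zero    (suc y) = mk⇔ (R-trans R0j ∘ ⇒ (same-class j y))
                                (⇐ (same-class j y) ∘ R-trans (R-sym R0j))
    same′ (suc x) zero    = mk⇔ (λ eq → R-trans (⇒ (same-class x j) eq) (R-sym R0j))
                                (λ r → ⇐ (same-class x j) (R-trans r R0j))
    same′ (suc x) (suc y) = same-class x y

  extend-with-new-class : (∀ j → ¬ R zero (suc j)) → Labelling R (suc t)
  extend-with-new-class ¬R0 = record
    { classOf = classOf′ ; representative = rep′
    ; classOf-rep = classOf-rep′ ; same-class = same′ }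
    where
    classOf′ : Fin (suc n) → Fin (suc t)
    classOf′ zero    = zero
    classOf′ (suc x) = suc (classOf x)
    rep′ : Fin (suc t) → Fin (suc n)
    rep′ zero    = zero
    rep′ (suc i) = suc (representative i)
    classOf-rep′ : ∀ i → classOf′ (rep′ i) ≡ i
    classOf-rep′ zero    = refl
    classOf-rep′ (suc i) = cong suc (classOf-rep i)
    same′ : ∀ x y → (classOf′ x ≡ classOf′ y) ⇔ R x y
    same′ zero    zero    = mk⇔ (λ _ → R-refl) (λ _ → refl)
    same′ zero    (suc y) = mk⇔ (λ ()) (⊥-elim ∘ ¬R0 y)
    same′ (suc x) zero    = mk⇔ (λ ()) (⊥-elim ∘ ¬R0 x ∘ R-sym)
    same′ (suc x) (suc y) = mk⇔ (⇒ (same-class x y) ∘ suc-injective)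
                                (cong suc ∘ ⇐ (same-class x y))

labelling : ∀ {n} {R : Rel (Fin n) 0ℓ} → IsDecEquivalence R → ∃ λ t → Labelling R t
labelling {zero} _ =
  zero , record { classOf = λ () ; representative = λ () ; classOf-rep = λ () ; same-class = λ () }
labelling {suc n} isDecEq
  with labelling (On.isDecEquivalence suc isDecEq) | any? (IsDecEquivalence._≟_ isDecEq zero ∘ suc)
... | t , L | yes (j , R0j) = t , extend-into-class isDecEq L j R0j
... | t , L | no ¬R0        = suc t , extend-with-new-class isDecEq L (λ j r → ¬R0 (j , r))

components : (H : Graph) → Finite H → DecAdj H → ∃ λ t → Components H t
components H (n , β) E? = t , record
  { label     = classOf ∘ to β
  ; rep       = from β ∘ representative
  ; rep-label = λ i → trans (cong classOf (strictlyInverseˡ β (representative i))) (classOf-rep i)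
  ; same      = λ x y → mk⇔
      (subst₂ (Reach H) (strictlyInverseʳ β x) (strictlyInverseʳ β y) ∘ ⇒ (same-class _ _))
      (⇐ (same-class _ _) ∘
       subst₂ (Reach H) (sym (strictlyInverseʳ β x)) (sym (strictlyInverseʳ β y)))
  }
  where
  reachability : IsDecEquivalence (λ i j → Reach H (from β i) (from β j))
  reachability = record
    { isEquivalence = record { refl = here ; sym = reach-sym ; trans = reach-trans }
    ; _≟_ = λ i j → reach? H β E? (from β i) (from β j)
    }
  t = proj₁ (labelling reachability)
  open Labelling (proj₂ (labelling reachability))

at-least-two-components : ∀ {H t} → Components H t → ∀ x y → ¬ Reach H x y →
                          ∃ λ k → Components H (suc (suc k))
at-least-two-components {t = zero}        L x y ¬r with label L x
... | ()
at-least-two-components {t = suc zero}    L x y ¬r =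
  ⊥-elim (¬r (⇒ (same L x y) (one (label L x) (label L y))))
  where
  one : (i j : Fin 1) → i ≡ j
  one zero zero = refl
at-least-two-components {t = suc (suc k)} L x y ¬r = k , L

-- Iterated joins

ι : ∀ {t} (H : Fin (suc t) → Graph) (i : Fin (suc t)) → V (H i) → V (bigJoin t H)
ι {zero}  H zero    p = p
ι {suc t} H zero    p = inj₁ p
ι {suc t} H (suc i) p = inj₂ (ι (H ∘ suc) i p)

ι⁻¹ : ∀ {t} (H : Fin (suc t) → Graph) → V (bigJoin t H) → Σ (Fin (suc t)) (V ∘ H)
ι⁻¹ {zero}  H p        = zero , p
ι⁻¹ {suc t} H (inj₁ p) = zero , p
ι⁻¹ {suc t} H (inj₂ z) = Product.map suc id (ι⁻¹ (H ∘ suc) z)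

ι-ι⁻¹ : ∀ {t} (H : Fin (suc t) → Graph) z → uncurry (ι H) (ι⁻¹ H z) ≡ z
ι-ι⁻¹ {zero}  H p        = refl
ι-ι⁻¹ {suc t} H (inj₁ p) = refl
ι-ι⁻¹ {suc t} H (inj₂ z) = cong inj₂ (ι-ι⁻¹ (H ∘ suc) z)

ι⁻¹-ι : ∀ {t} (H : Fin (suc t) → Graph) i p → ι⁻¹ H (ι H i p) ≡ (i , p)
ι⁻¹-ι {zero}  H zero    p = refl
ι⁻¹-ι {suc t} H zero    p = refl
ι⁻¹-ι {suc t} H (suc i) p = cong (Product.map suc id) (ι⁻¹-ι (H ∘ suc) i p)

ι-inside : ∀ {t} (H : Fin (suc t) → Graph) i {p q} →
           E (bigJoin t H) (ι H i p) (ι H i q) ⇔ E (H i) p q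
ι-inside {zero}  H zero    = mk⇔ id id
ι-inside {suc t} H zero    = mk⇔ id id
ι-inside {suc t} H (suc i) = ι-inside (H ∘ suc) i

ι-across : ∀ {t} (H : Fin (suc t) → Graph) {i j} p q → i ≢ j →
           E (bigJoin t H) (ι H i p) (ι H j q)
ι-across {zero}  H {zero}  {zero}  p q i≢j = contradiction refl i≢j
ι-across {suc t} H {zero}  {zero}  p q i≢j = contradiction refl i≢j
ι-across {suc t} H {zero}  {suc j} p q i≢j = tt
ι-across {suc t} H {suc i} {zero}  p q i≢j = tt
ι-across {suc t} H {suc i} {suc j} p q i≢j = ι-across (H ∘ suc) p q (i≢j ∘ cong suc)

AdjacentAcross : {A : Set} (G : Graph) → (V G → A) → Set
AdjacentAcross G lab = ∀ x y → lab x ≢ lab y → E G x y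

partition⇒join : (G : Graph) {t : ℕ} (lab : V G → Fin (suc t)) (H : Fin (suc t) → Graph) →
  (emb : ∀ i → V (H i) ↔ Σ (V G) (λ v → lab v ≡ i)) →
  (∀ i p q → E (H i) p q ⇔ E G (proj₁ (to (emb i) p)) (proj₁ (to (emb i) q))) →
  AdjacentAcross G lab → G ≅ bigJoin t H
partition⇒join G {t} lab H emb adj-inside adj-across = record
  { bij  = mk↔ₛ′ vertex unvertex vertex-unvertex unvertex-vertex
  ; adj⇔ = λ x y → adj x y refl refl
  }
  where
  piece : ∀ x {i} → lab x ≡ i → V (H i)
  piece x e = from (emb _) (x , e)

  vertex : V G → V (bigJoin t H)
  vertex x = ι H (lab x) (piece x refl)

  unvertex : V (bigJoin t H) → V G
  unvertex z = proj₁ (to (emb _) (proj₂ (ι⁻¹ H z)))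

  vertex-piece : ∀ x {i} (e : lab x ≡ i) → vertex x ≡ ι H i (piece x e)
  vertex-piece x refl = refl

  vertex-unvertex : ∀ z → vertex (unvertex z) ≡ z
  vertex-unvertex z = begin
    vertex (unvertex z)                     ≡⟨ vertex-piece _ (proj₂ (to (emb i) p)) ⟩
    ι H i (from (emb i) (to (emb i) p))    ≡⟨ cong (ι H i) (strictlyInverseʳ (emb i) p) ⟩
    ι H i p                                 ≡⟨ ι-ι⁻¹ H z ⟩
    z                                       ∎
    where
    open ≡-Reasoning
    i = proj₁ (ι⁻¹ H z)
    p = proj₂ (ι⁻¹ H z)

  unvertex-vertex : ∀ x → unvertex (vertex x) ≡ x
  unvertex-vertex x = begin
    unvertex (vertex x)
      ≡⟨ cong (λ (i , p) → proj₁ (to (emb i) p)) (ι⁻¹-ι H _ _) ⟩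
    proj₁ (to (emb (lab x)) (from (emb (lab x)) (x , refl)))
      ≡⟨ cong proj₁ (strictlyInverseˡ (emb _) _) ⟩
    x ∎
    where open ≡-Reasoning

  piece-adj : ∀ x y {i} (ex : lab x ≡ i) (ey : lab y ≡ i) →
              E (H i) (piece x ex) (piece y ey) ⇔ E G x y
  piece-adj x y ex ey = subst₂ (λ a b → E (H _) (piece x ex) (piece y ey) ⇔ E G a b)
    (cong proj₁ (strictlyInverseˡ (emb _) (x , ex)))
    (cong proj₁ (strictlyInverseˡ (emb _) (y , ey)))
    (adj-inside _ _ _)

  adj : ∀ x y {i j} (ex : lab x ≡ i) (ey : lab y ≡ j) →
        E G x y ⇔ E (bigJoin t H) (ι H i (piece x ex)) (ι H j (piece y ey))
  adj x y {i} {j} ex ey with i ≟ j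
  ... | yes refl = mk⇔ (⇐ (ι-inside H i) ∘ ⇐ (piece-adj x y ex ey))
                       (⇒ (piece-adj x y ex ey) ∘ ⇒ (ι-inside H i))
  ... | no i≢j   = mk⇔ (λ _ → ι-across H _ _ i≢j)
                       (λ _ → adj-across x y (λ e → i≢j (trans (sym ex) (trans e ey))))

-- Graphs of diameter at most two

Diam≤2 : Graph → Set
Diam≤2 G = ∀ x y → x ≢ y → ¬ E G x y → Dist2 G x y

metamour≅complement : ∀ {G} → Diam≤2 G → metamour G ≅ complement G
metamour≅complement diam = record
  { bij  = ↔-id _
  ; adj⇔ = λ x y → mk⇔ (λ (x≢y , ¬xy , _) → x≢y , ¬xy) (uncurry (diam x y))
  }

adjacentAcross⇒diam≤2 : ∀ {A G} {lab : V G → A} → AdjacentAcross G lab →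
                        (∀ a → ∃ λ z → lab z ≢ a) → Diam≤2 G
adjacentAcross⇒diam≤2 {lab = lab} across other x y x≢y ¬xy =
  x≢y , ¬xy , z , across x z (z∉x ∘ sym) , across z y z∉y
  where
  z = proj₁ (other (lab x))
  z∉x = proj₂ (other (lab x))
  z∉y : lab z ≢ lab y
  z∉y zy = ¬xy (across x y (λ xy → z∉x (trans zy (sym xy))))

adjacentAcross-metamour-reach : ∀ {A G} {lab : V G → A} → DecidableEquality A →
  AdjacentAcross G lab → ∀ {x y} → Reach (metamour G) x y → lab x ≡ lab y
adjacentAcross-metamour-reach _≟A_ across here = refl
adjacentAcross-metamour-reach {G = G} {lab} _≟A_ across {x} (step {y = z} (_ , ¬xz , _) r) =
  trans (decidable-stable (lab x ≟A lab z) (¬xz ∘ across x z))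
        (adjacentAcross-metamour-reach {G = G} _≟A_ across r)

complement-components-adjacentAcross : ∀ {G t} → DecAdj G → (L : Components (complement G) t) →
                                       AdjacentAcross G (label L)
complement-components-adjacentAcross E? L x y ne =
  decidable-stable (E? x y)
    (λ ¬xy → ne (⇐ (same L x y) (step (ne ∘ cong (label L) , ¬xy) here)))

other-component : ∀ {H k} (L : Components H (suc (suc k))) → ∀ i → ∃ λ z → label L z ≢ i
other-component L i = rep L (punchIn i zero) , punchInᵢ≢i i zero ∘ trans (sym (rep-label L _))

fiber-≡ : ∀ {A : Set} {n} {f : A → Fin n} {i} {p q : Σ A λ a → f a ≡ i} →
          proj₁ p ≡ proj₁ q → p ≡ q
fiber-≡ {p = a , e} {q = .a , e′} refl = cong (a ,_) (Decidable⇒UIP.≡-irrelevant _≟_ e e′)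

-- ψ need not be the identity, but it makes complement G disconnected, so G has
-- diameter two and the metamour graph is literally the complement.
metamour-components⇒join : ∀ {G k} → DecAdj G → metamour G ≅ complement G →
  (L : Components (metamour G) (suc (suc k))) →
  G ≅ bigJoin (suc k) (λ i → complement (component (metamour G) L i))
metamour-components⇒join {G} E? ψ L =
  partition⇒join G (label L) (complement ∘ component (metamour G) L) (λ i → ↔-id _) inside across
  where
  L̄ = components-≅ ψ L

  diam : Diam≤2 G
  diam = adjacentAcross⇒diam≤2 {G = G}
           (complement-components-adjacentAcross {G = G} E? L̄) (other-component L̄)

  across : AdjacentAcross G (label L)
  across = complement-components-adjacentAcross {G = G} E?
             (components-≅ (metamour≅complement {G} diam) L)

  inside : ∀ i p q → E (complement (component (metamour G) L i)) p q ⇔ E G (proj₁ p) (proj₁ q)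
  inside i p q = mk⇔
    (λ (p≢q , ¬pq) → decidable-stable (E? _ _) (¬pq ∘ diam _ _ (p≢q ∘ fiber-≡)))
    (λ pq → (λ p≡q → E-irr G (subst (E G (proj₁ p)) (cong proj₁ (sym p≡q)) pq))
          , λ (_ , ¬pq , _) → ¬pq pq)

-- Binary joins

isLeft : {A B : Set} → A ⊎ B → Bool
isLeft (inj₁ _) = true
isLeft (inj₂ _) = false

module _ {G G₁ G₂ : Graph} (φ : G ≅ (G₁ ∇ G₂)) where
  private b = bij φ

  join-adjacentAcross : AdjacentAcross G (isLeft ∘ to b)
  join-adjacentAcross x y ne = ⇐ (adj⇔ φ x y) (across (to b x) (to b y) ne)
    where
    across : ∀ u w → isLeft u ≢ isLeft w → JE G₁ G₂ u w
    across (inj₁ _) (inj₁ _) ne = contradiction refl ne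
    across (inj₂ _) (inj₂ _) ne = contradiction refl ne
    across (inj₁ _) (inj₂ _) _  = tt
    across (inj₂ _) (inj₁ _) _  = tt

  isLeft-from : ∀ u → isLeft (to b (from b u)) ≡ isLeft u
  isLeft-from u = cong isLeft (strictlyInverseˡ b u)

  join-other-side : ∀ s → ∃ λ z → isLeft (to b z) ≢ s
  join-other-side true  = from b (inj₂ (point G₂)) , (λ ()) ∘ trans (sym (isLeft-from _))
  join-other-side false = from b (inj₁ (point G₁)) , (λ ()) ∘ trans (sym (isLeft-from _))

  join⇒diam≤2 : Diam≤2 G
  join⇒diam≤2 = adjacentAcross⇒diam≤2 {G = G} join-adjacentAcross join-other-side

  join⇒metamour-disconnected :
    ¬ Reach (metamour G) (from b (inj₁ (point G₁))) (from b (inj₂ (point G₂)))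
  join⇒metamour-disconnected r = contradiction
    (trans (sym (isLeft-from _))
           (trans (adjacentAcross-metamour-reach {G = G} Bool._≟_ join-adjacentAcross r)
                  (isLeft-from _)))
    λ ()

  join⇒disconnected-metamour≅complement : Finite G → DecAdj G →
    (metamour G ≅ complement G) × ∃ λ k → Components (metamour G) (suc (suc k))
  join⇒disconnected-metamour≅complement fin@(_ , β) E? =
      metamour≅complement {G} join⇒diam≤2
    , at-least-two-components (proj₂ (components (metamour G) fin M?)) _ _
                              join⇒metamour-disconnected
    where
    M? : DecAdj (metamour G)
    M? x y = map′ (uncurry (join⇒diam≤2 x y)) (λ (x≢y , ¬xy , _) → x≢y , ¬xy)
                  (¬? (inj⇒≟ (↔⇒↣ β) x y) ×-dec ¬? (E? x y))

proposition2p12 : (G : Graph) → Finite G → DecAdj G → Connected G →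
    let M = metamour G
        A = (M ≅ complement G) × Σ ℕ (λ k → Components M (suc (suc k)))
        B = Σ ℕ (λ k → Σ (Components M (suc (suc k))) (λ L →
              G ≅ bigJoin (suc k) (λ i → complement (component M L i))))
        C = Σ Graph (λ G₁ → Σ Graph (λ G₂ → G ≅ (G₁ ∇ G₂)))
    in (A ⇔ B) × (A ⇔ C)
proposition2p12 G fin E? _ =
    mk⇔ (λ (ψ , k , L) → k , L , metamour-components⇒join E? ψ L)
        (λ (_ , _ , φ) → join⇒disconnected-metamour≅complement φ fin E?)
  , mk⇔ (λ (ψ , k , L) → _ , _ , metamour-components⇒join E? ψ L)
        (λ (_ , _ , φ) → join⇒disconnected-metamour≅complement φ fin E?)
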